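{- Let $a\in\mathbb{Z}$, $m\in\mathbb{N}$ and $t\in\{2,\ldots,m\}$. Let $A\in\mathbb{Z}^{m\times m}$ have entries, for $l\in\{1,\dots,m\}$, \[A_{li}=\begin{cases}\binom{a+l}{i-1} & t\le i\le m,\\ \binom{a+l+1}{i-1} & 1\le i<t.\end{cases}\] Then $\det A=1$.
   Context: For $x\in\mathbb{Z}$ and an integer $n\ge0$, $\binom{x}{n}=x(x-1)\cdots(x-n+1)/n!$ (so negative upper arguments are allowed). -}

module Defs where

open import Data.Nat as ℕ using (ℕ; zero; suc; _!)
open import Data.Nat.Properties using (_!≢0)
open import Data.Integer using (ℤ; +_; _+_; _-_; _*_; -_)
open import Data.Integer.DivMod using (_/ℕ_)
open import Data.Fin using (Fin; zero; suc; punchIn)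

falling : ℤ → ℕ → ℤ
falling x zero    = + 1
falling x (suc n) = falling x n * (x - + n)

-- generalized binomial coefficient  binom x n = x(x-1)...(x-n+1)/n!
-- (the division is exact; written with integer division by n!)
binom : ℤ → ℕ → ℤ
binom x n = _/ℕ_ (falling x n) (n !) {{n !≢0}}

Matrix : ℕ → Set
Matrix n = Fin n → Fin n → ℤ

minor : ∀ {n} → Matrix (suc n) → Fin (suc n) → Matrix n
minor A j r c = A (suc r) (punchIn j c)

altSum : ∀ {n} → (Fin n → ℤ) → ℤ
altSum {zero}  f = + 0
altSum {suc n} f = f zero - altSum (λ j → f (suc j))

det : ∀ {n} → Matrix n → ℤ
det {zero}  A = + 1
det {suc n} A = altSum (λ j → A zero j * det (minor A j))

module Submission where

-- Replacing every row but the first by its difference with the row above does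
-- not change the determinant, and by Pascal's rule it turns the matrix into one
-- with first column (1, 0, …, 0) whose lower-right block is a matrix of the same
-- shape, of size one less and with the column threshold t lowered by one.
-- Induction on the size then gives det = 1, for every a and t.

open import Defs
open import Data.Nat using (ℕ; suc; _≤_; _<_)
open import Data.Fin using (Fin; toℕ)
open import Data.Integer using (ℤ; +_; _+_)
open import Data.Bool using (if_then_else_)
open import Relation.Nullary.Decidable using (⌊_⌋)
open import Data.Nat using (_<?_)
open import Relation.Binary.PropositionalEquality using (_≡_)

module GeneralizedBinomial where

  open import Data.Nat as ℕ using (zero; suc; _!)
  open import Data.Nat.Properties using (_!≢0)
  open import Data.Nat.DivMod using (m*n/n≡m; m*n%n≡0)
  open import Data.Integer using (-[1+_]; _-_; _*_; -_; 1ℤ) renaming (suc to sucℤ)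
  open import Data.Integer.DivMod using (_/ℕ_)
  open import Data.Integer.Properties using (pos-*; *-cancelʳ-≡)
  open import Data.Integer.Divisibility.Signed using (_∣_; divides; ∣m∣n⇒∣m+n; ∣m+n∣n⇒∣m; *-monoʳ-∣)
  open import Data.Integer.Solver using (module +-*-Solver)
  open +-*-Solver
  open import Relation.Binary.PropositionalEquality using (refl; sym; cong; cong₂; subst; module ≡-Reasoning)

  ℤ-induction : (P : ℤ → Set) → P (+ 0) →
    (∀ x → P x → P (sucℤ x)) → (∀ x → P (sucℤ x) → P x) → ∀ x → P x
  ℤ-induction P p₀ up down (+ zero)      = p₀
  ℤ-induction P p₀ up down (+ suc n)     = up (+ n) (ℤ-induction P p₀ up down (+ n))
  ℤ-induction P p₀ up down -[1+ zero ]   = down -[1+ zero ] p₀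
  ℤ-induction P p₀ up down -[1+ suc n ]  = down -[1+ suc n ] (ℤ-induction P p₀ up down -[1+ n ])

  exact-/ℕ : ∀ q d .{{_ : ℕ.NonZero d}} → (q * + d) /ℕ d ≡ q
  exact-/ℕ (+ n) d rewrite sym (pos-* n d) = cong +_ (m*n/n≡m n d)
  exact-/ℕ -[1+ n ] d@(suc _) rewrite m*n%n≡0 (suc n) d {{_}} = cong (λ z → - (+ z)) (m*n/n≡m (suc n) d)

  falling-sucℤ : ∀ x k → falling (sucℤ x) (suc k) ≡ sucℤ x * falling x k
  falling-sucℤ x zero = solve 1 (λ x → con 1ℤ :* ((con 1ℤ :+ x) :- con (+ 0)) := (con 1ℤ :+ x) :* con 1ℤ) refl x
  falling-sucℤ x (suc k) = begin
      falling (sucℤ x) (suc k) * (sucℤ x - + suc k) ≡⟨ cong (_* (sucℤ x - + suc k)) (falling-sucℤ x k) ⟩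
      sucℤ x * falling x k * (sucℤ x - + suc k)     ≡⟨ shift x (falling x k) (+ k) ⟩
      sucℤ x * (falling x k * (x - + k))             ∎
    where
    open ≡-Reasoning
    shift : ∀ x f k → (1ℤ + x) * f * ((1ℤ + x) - (1ℤ + k)) ≡ (1ℤ + x) * (f * (x - k))
    shift = solve 3 (λ x f k → (con 1ℤ :+ x) :* f :* ((con 1ℤ :+ x) :- (con 1ℤ :+ k))
                                := (con 1ℤ :+ x) :* (f :* (x :- k))) refl

  falling-pascal : ∀ x k → falling (sucℤ x) (suc k) ≡ falling x (suc k) + + suc k * falling x k
  falling-pascal x k = begin
      falling (sucℤ x) (suc k)                   ≡⟨ falling-sucℤ x k ⟩
      sucℤ x * falling x k                       ≡⟨ regroup x (falling x k) (+ k) ⟩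
      falling x k * (x - + k) + + suc k * falling x k ∎
    where
    open ≡-Reasoning
    regroup : ∀ x f k → (1ℤ + x) * f ≡ f * (x - k) + (1ℤ + k) * f
    regroup = solve 3 (λ x f k → (con 1ℤ :+ x) :* f := f :* (x :- k) :+ (con 1ℤ :+ k) :* f) refl

  falling-zero : ∀ k → falling (+ 0) (suc k) ≡ + 0
  falling-zero zero = refl
  falling-zero (suc k) rewrite falling-zero k = refl

  -- k! divides x(x-1)…(x-k+1) for every integer x: true at x = 0 and, by
  -- falling-pascal and induction on k, preserved by x ↦ x ± 1.
  factorial∣falling : ∀ k x → + (k !) ∣ falling x k
  factorial∣falling zero x = divides (+ 1) refl
  factorial∣falling (suc k) = ℤ-induction (λ x → + (suc k !) ∣ falling x (suc k))
      (divides (+ 0) (falling-zero k)) up down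
    where
    difference : ∀ x → + (suc k !) ∣ + suc k * falling x k
    difference x = subst (_∣ + suc k * falling x k) (sym (pos-* (suc k) (k !))) (*-monoʳ-∣ (+ suc k) (factorial∣falling k x))
    up : ∀ x → + (suc k !) ∣ falling x (suc k) → + (suc k !) ∣ falling (sucℤ x) (suc k)
    up x d = subst (+ (suc k !) ∣_) (sym (falling-pascal x k)) (∣m∣n⇒∣m+n d (difference x))
    down : ∀ x → + (suc k !) ∣ falling (sucℤ x) (suc k) → + (suc k !) ∣ falling x (suc k)
    down x d = ∣m+n∣n⇒∣m (subst (+ (suc k !) ∣_) (falling-pascal x k) d) (difference x)

  falling≡binom*factorial : ∀ x k → falling x k ≡ binom x k * + (k !)
  falling≡binom*factorial x k with factorial∣falling k x
  ... | divides q eq rewrite eq = cong (_* + (k !)) (sym (exact-/ℕ q (k !) {{k !≢0}}))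

  binom-zero : ∀ x → binom x 0 ≡ + 1
  binom-zero x = refl

  -- Pascal's rule for integer upper arguments, obtained from falling-pascal by
  -- cancelling the nonzero factor (k+1)!.
  binom-pascal : ∀ x k → binom (sucℤ x) (suc k) ≡ binom x (suc k) + binom x k
  binom-pascal x k = *-cancelʳ-≡ _ _ (+ (suc k !)) {{suc k !≢0}} (begin
      binom (sucℤ x) (suc k) * + (suc k !)         ≡⟨ sym (falling≡binom*factorial (sucℤ x) (suc k)) ⟩
      falling (sucℤ x) (suc k)                     ≡⟨ falling-pascal x k ⟩
      falling x (suc k) + + suc k * falling x k    ≡⟨ cong₂ (λ u v → u + + suc k * v)
                                                        (falling≡binom*factorial x (suc k)) (falling≡binom*factorial x k) ⟩
      binom x (suc k) * + (suc k !) + + suc k * (binom x k * + (k !))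
                                                   ≡⟨ cong (λ f → binom x (suc k) * + (suc k !) + f)
                                                        (regroup (+ suc k) (binom x k) (+ (k !))) ⟩
      binom x (suc k) * + (suc k !) + binom x k * (+ suc k * + (k !))
                                                   ≡⟨ cong (λ f → binom x (suc k) * + (suc k !) + binom x k * f)
                                                        (sym (pos-* (suc k) (k !))) ⟩
      binom x (suc k) * + (suc k !) + binom x k * + (suc k !)
                                                   ≡⟨ distrib (binom x (suc k)) (binom x k) (+ (suc k !)) ⟩
      (binom x (suc k) + binom x k) * + (suc k !)  ∎)
    where
    open ≡-Reasoning
    regroup : ∀ s b f → s * (b * f) ≡ b * (s * f)
    regroup = solve 3 (λ s b f → s :* (b :* f) := b :* (s :* f)) refl
    distrib : ∀ u v f → u * f + v * f ≡ (u + v) * f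
    distrib = solve 3 (λ u v f → u :* f :+ v :* f := (u :+ v) :* f) refl

module Determinant where

  open import Data.Nat using (zero; suc)
  open import Data.Integer using (_-_; _*_)
  open import Data.Integer.Properties using (*-zeroʳ)
  open import Data.Fin using (zero; suc; punchIn; inject₁)
  open import Data.Integer.Solver using (module +-*-Solver)
  open +-*-Solver
  open import Relation.Binary.PropositionalEquality using (refl; sym; trans; cong; cong₂; module ≡-Reasoning)

  altSum-cong : ∀ {n} {f g : Fin n → ℤ} → (∀ j → f j ≡ g j) → altSum f ≡ altSum g
  altSum-cong {zero}  e = refl
  altSum-cong {suc n} e = cong₂ _-_ (e zero) (altSum-cong (λ j → e (suc j)))

  altSum-zero : ∀ {n} {f : Fin n → ℤ} → (∀ j → f j ≡ + 0) → altSum f ≡ + 0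
  altSum-zero {zero}  e = refl
  altSum-zero {suc n} e rewrite e zero | altSum-zero (λ j → e (suc j)) = refl

  altSum-sub : ∀ {n} (f g : Fin n → ℤ) → altSum (λ j → f j - g j) ≡ altSum f - altSum g
  altSum-sub {zero}  f g = refl
  altSum-sub {suc n} f g rewrite altSum-sub (λ j → f (suc j)) (λ j → g (suc j)) =
    solve 4 (λ a b c d → (a :- b) :- (c :- d) := (a :- c) :- (b :- d)) refl (f zero) (g zero) _ _

  altSum-scale : ∀ {n} (c : ℤ) (f : Fin n → ℤ) → altSum (λ j → c * f j) ≡ c * altSum f
  altSum-scale {zero}  c f = solve 1 (λ c → con (+ 0) := c :* con (+ 0)) refl c
  altSum-scale {suc n} c f rewrite altSum-scale c (λ j → f (suc j)) =
    solve 3 (λ c a b → c :* a :- c :* b := c :* (a :- b)) refl c (f zero) _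

  altSum-swap : ∀ {n m} (F : Fin n → Fin m → ℤ) →
    altSum (λ i → altSum (λ j → F i j)) ≡ altSum (λ j → altSum (λ i → F i j))
  altSum-swap {zero} {m} F = sym (altSum-zero {m} (λ j → refl))
  altSum-swap {suc n} F rewrite altSum-swap (λ i j → F (suc i) j) =
    sym (altSum-sub (F zero) (λ j → altSum (λ i → F (suc i) j)))

  altSum-bilinear-swap : ∀ {n m} (u : Fin m → ℤ) (v : Fin n → ℤ) (D : Fin n → Fin m → ℤ) →
    altSum (λ j → u j * altSum (λ i → v i * D i j)) ≡ altSum (λ i → v i * altSum (λ j → u j * D i j))
  altSum-bilinear-swap u v D = begin
      altSum (λ j → u j * altSum (λ i → v i * D i j))
        ≡⟨ altSum-cong (λ j → sym (altSum-scale (u j) (λ i → v i * D i j))) ⟩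
      altSum (λ j → altSum (λ i → u j * (v i * D i j)))
        ≡⟨ sym (altSum-swap (λ i j → u j * (v i * D i j))) ⟩
      altSum (λ i → altSum (λ j → u j * (v i * D i j)))
        ≡⟨ altSum-cong (λ i → altSum-cong (λ j → commute (u j) (v i) (D i j))) ⟩
      altSum (λ i → altSum (λ j → v i * (u j * D i j)))
        ≡⟨ altSum-cong (λ i → altSum-scale (v i) (λ j → u j * D i j)) ⟩
      altSum (λ i → v i * altSum (λ j → u j * D i j)) ∎
    where
    open ≡-Reasoning
    commute : ∀ a b d → a * (b * d) ≡ b * (a * d)
    commute = solve 3 (λ a b d → a :* (b :* d) := b :* (a :* d)) refl

  det-cong : ∀ {n} {A B : Matrix n} → (∀ r c → A r c ≡ B r c) → det A ≡ det B
  det-cong {zero}  e = refl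
  det-cong {suc n} e = altSum-cong (λ j → cong₂ _*_ (e zero j) (det-cong (λ r c → e (suc r) (punchIn j c))))

  minorAt : ∀ {n} → Matrix (suc n) → Fin (suc n) → Fin (suc n) → Matrix n
  minorAt A i j r c = A (punchIn i r) (punchIn j c)

  -- Laplace expansion along the first column: expand every first-row minor
  -- along its first column and exchange the two alternating sums.
  det-column-expansion : ∀ {n} (A : Matrix (suc n)) →
    det A ≡ altSum (λ i → A i zero * det (minorAt A i zero))
  det-column-expansion {zero}  A = refl
  det-column-expansion {suc n} A = cong (A zero zero * det (minor A zero) -_) (begin
      altSum (λ j → A zero (suc j) * det (minor A (suc j)))
        ≡⟨ altSum-cong (λ j → cong (A zero (suc j) *_) (det-column-expansion (minor A (suc j)))) ⟩
      altSum (λ j → A zero (suc j) * altSum (λ i → A (suc i) zero * D i j))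
        ≡⟨ altSum-bilinear-swap (λ j → A zero (suc j)) (λ i → A (suc i) zero) D ⟩
      altSum (λ i → A (suc i) zero * altSum (λ j → A zero (suc j) * D i j)) ∎)
    where
    open ≡-Reasoning
    D : Fin (suc n) → Fin (suc n) → ℤ
    D i j = det (λ r c → A (suc (punchIn i r)) (suc (punchIn j c)))

  -- A matrix whose first two rows coincide has determinant 0: in the expansion
  -- along the first column the first two terms cancel, and every further minor
  -- still contains the two equal rows.
  det-equal-rows : ∀ {n} (A : Matrix (suc (suc n))) → (∀ c → A zero c ≡ A (suc zero) c) → det A ≡ + 0
  det-equal-rows {n} A same = begin
      det A
        ≡⟨ det-column-expansion A ⟩
      A zero zero * det (minorAt A zero zero) - (A (suc zero) zero * det (minorAt A (suc zero) zero) - rest)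
        ≡⟨ cong₂ (λ a d → a * det (minorAt A zero zero) - (A (suc zero) zero * d - rest))
             (same zero) (det-cong first-minors) ⟩
      a₁ * det (minorAt A zero zero) - (a₁ * det (minorAt A zero zero) - rest)
        ≡⟨ cong (λ z → a₁ * det (minorAt A zero zero) - (a₁ * det (minorAt A zero zero) - z))
             (altSum-zero (λ i → trans (cong (A (suc (suc i)) zero *_) (further-minors n A same i))
                                       (*-zeroʳ (A (suc (suc i)) zero)))) ⟩
      a₁ * det (minorAt A zero zero) - (a₁ * det (minorAt A zero zero) - + 0)
        ≡⟨ solve 1 (λ d → d :- (d :- con (+ 0)) := con (+ 0)) refl (a₁ * det (minorAt A zero zero)) ⟩
      + 0 ∎
    where
    open ≡-Reasoning
    a₁ : ℤ
    a₁ = A (suc zero) zero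
    rest : ℤ
    rest = altSum (λ i → A (suc (suc i)) zero * det (minorAt A (suc (suc i)) zero))
    first-minors : ∀ r c → minorAt A (suc zero) zero r c ≡ minorAt A zero zero r c
    first-minors zero    c = same (suc c)
    first-minors (suc r) c = refl
    further-minors : ∀ n (A : Matrix (suc (suc n))) → (∀ c → A zero c ≡ A (suc zero) c) →
      ∀ i → det (minorAt A (suc (suc i)) zero) ≡ + 0
    further-minors zero    A same ()
    further-minors (suc n) A same i = det-equal-rows (minorAt A (suc (suc i)) zero) (λ c → same (suc c))

  det-linear-row0 : ∀ {n} (A B C : Matrix (suc n)) → (∀ c → A zero c ≡ B zero c - C zero c) →
    (∀ r c → B (suc r) c ≡ A (suc r) c) → (∀ r c → C (suc r) c ≡ A (suc r) c) →
    det A ≡ det B - det C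
  det-linear-row0 A B C first eB eC = begin
      altSum (λ j → A zero j * det (minor A j))
        ≡⟨ altSum-cong (λ j → cong (_* det (minor A j)) (first j)) ⟩
      altSum (λ j → (B zero j - C zero j) * det (minor A j))
        ≡⟨ altSum-cong (λ j → distrib (B zero j) (C zero j) (det (minor A j))) ⟩
      altSum (λ j → B zero j * det (minor A j) - C zero j * det (minor A j))
        ≡⟨ altSum-cong (λ j → cong₂ (λ b c → B zero j * b - C zero j * c)
             (sym (det-cong (λ r c → eB r (punchIn j c)))) (sym (det-cong (λ r c → eC r (punchIn j c))))) ⟩
      altSum (λ j → B zero j * det (minor B j) - C zero j * det (minor C j))
        ≡⟨ altSum-sub (λ j → B zero j * det (minor B j)) (λ j → C zero j * det (minor C j)) ⟩
      det B - det C ∎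
    where
    open ≡-Reasoning
    distrib : ∀ b c d → (b - c) * d ≡ b * d - c * d
    distrib = solve 3 (λ b c d → (b :- c) :* d := b :* d :- c :* d) refl

  rowDifferences : ∀ {n} → Matrix (suc n) → Matrix (suc n)
  rowDifferences A zero    c = A zero c
  rowDifferences A (suc l) c = A (suc l) c - A (inject₁ l) c

  -- Expanding along
  -- row 0, the minor of rowDifferences A has first row A₁ - A₀; by linearity it
  -- splits into rowDifferences of the minor of A (handled by induction) and the
  -- minor of a matrix H with two equal leading rows A₀, A₀ (determinant 0).
  det-rowDifferences : ∀ {n} (A : Matrix (suc n)) → det (rowDifferences A) ≡ det A
  det-rowDifferences {zero}  A = refl
  det-rowDifferences {suc n} A = begin
      altSum (λ j → A zero j * det (minor (rowDifferences A) j))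
        ≡⟨ altSum-cong (λ j → cong (A zero j *_) (trans
             (det-linear-row0 (minor (rowDifferences A) j) (rowDifferences (minor A j)) (minor H j)
               (λ c → refl) (λ r c → refl) (λ r c → refl))
             (cong (_- det (minor H j)) (det-rowDifferences (minor A j))))) ⟩
      altSum (λ j → A zero j * (det (minor A j) - det (minor H j)))
        ≡⟨ altSum-cong (λ j → distrib (A zero j) (det (minor A j)) (det (minor H j))) ⟩
      altSum (λ j → A zero j * det (minor A j) - H zero j * det (minor H j))
        ≡⟨ altSum-sub (λ j → A zero j * det (minor A j)) (λ j → H zero j * det (minor H j)) ⟩
      det A - det H
        ≡⟨ cong (det A -_) (det-equal-rows H (λ c → refl)) ⟩
      det A - + 0
        ≡⟨ solve 1 (λ d → d :- con (+ 0) := d) refl (det A) ⟩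
      det A ∎
    where
    open ≡-Reasoning
    H : Matrix (suc (suc n))
    H zero          c = A zero c
    H (suc zero)    c = A zero c
    H (suc (suc r)) c = rowDifferences A (suc (suc r)) c
    distrib : ∀ a b c → a * (b - c) ≡ a * b - a * c
    distrib = solve 3 (λ a b c → a :* (b :- c) := a :* b :- a :* c) refl

  det-first-column : ∀ {n} (A : Matrix (suc n)) → (∀ r → A (suc r) zero ≡ + 0) →
    det A ≡ A zero zero * det (minor A zero)
  det-first-column A below = begin
      det A
        ≡⟨ det-column-expansion A ⟩
      A zero zero * det (minor A zero) - altSum (λ i → A (suc i) zero * det (minorAt A (suc i) zero))
        ≡⟨ cong (A zero zero * det (minor A zero) -_)
             (altSum-zero (λ i → cong (_* det (minorAt A (suc i) zero)) (below i))) ⟩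
      A zero zero * det (minor A zero) - + 0
        ≡⟨ solve 1 (λ d → d :- con (+ 0) := d) refl (A zero zero * det (minor A zero)) ⟩
      A zero zero * det (minor A zero) ∎
    where open ≡-Reasoning

module BinomialMatrix where

  open GeneralizedBinomial using (binom-zero; binom-pascal)
  open Determinant using (det-cong; rowDifferences; det-rowDifferences; det-first-column)
  open import Data.Nat using (zero; suc; _∸_; s≤s; s≤s⁻¹)
  open import Data.Fin using (zero; suc; inject₁)
  open import Data.Fin.Properties using (toℕ-inject₁)
  open import Data.Integer using (_-_; _*_; 1ℤ) renaming (suc to sucℤ)
  open import Data.Integer.Properties using (*-identityˡ)
  open import Data.Integer.Solver using (module +-*-Solver)
  open +-*-Solver using (solve; _:+_; _:-_; _:=_; con)
  open import Data.Bool using (true; false)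
  open import Data.Empty using (⊥-elim)
  open import Relation.Nullary using (yes; no)
  open import Relation.Binary.PropositionalEquality using (refl; cong; cong₂; module ≡-Reasoning)

  -- Entry (l, i) of the matrix of the corollary, rows and columns counted from 0:
  -- binom (a + l + 2) i in the columns i with i + 1 < t, binom (a + l + 1) i in the others.
  entry : ℤ → ℕ → ℕ → ℕ → ℤ
  entry a t l i = if ⌊ suc i <? t ⌋ then binom (a + + suc (suc l)) i else binom (a + + suc l) i

  binomialMatrix : ℤ → ℕ → ∀ {m} → Matrix m
  binomialMatrix a t l i = entry a t (toℕ l) (toℕ i)

  entry-column0 : ∀ a t l → entry a t l 0 ≡ + 1
  entry-column0 a t l with ⌊ 1 <? t ⌋
  ... | true  = binom-zero (a + + suc (suc l))
  ... | false = binom-zero (a + + suc l)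

  <?-suc : ∀ i t → ⌊ suc i <? suc t ⌋ ≡ ⌊ i <? t ⌋
  <?-suc i t with suc i <? suc t | i <? t
  ... | yes _   | yes _   = refl
  ... | no _    | no _    = refl
  ... | yes i<t | no i≮t  = ⊥-elim (i≮t (s≤s⁻¹ i<t))
  ... | no i≮t  | yes i<t = ⊥-elim (i≮t (s≤s i<t))

  binom-row-difference : ∀ a l i → binom (a + + suc l) (suc i) - binom (a + + l) (suc i) ≡ binom (a + + l) i
  binom-row-difference a l i = begin
      binom (a + + suc l) (suc i) - binom (a + + l) (suc i)
        ≡⟨ cong (λ x → binom x (suc i) - binom (a + + l) (suc i)) (shift a (+ l)) ⟩
      binom (sucℤ (a + + l)) (suc i) - binom (a + + l) (suc i)
        ≡⟨ cong (_- binom (a + + l) (suc i)) (binom-pascal (a + + l) i) ⟩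
      binom (a + + l) (suc i) + binom (a + + l) i - binom (a + + l) (suc i)
        ≡⟨ solve 2 (λ u v → u :+ v :- u := v) refl (binom (a + + l) (suc i)) (binom (a + + l) i) ⟩
      binom (a + + l) i ∎
    where
    open ≡-Reasoning
    shift : ∀ a l → a + (1ℤ + l) ≡ 1ℤ + (a + l)
    shift = solve 2 (λ a l → a :+ (con 1ℤ :+ l) := con 1ℤ :+ (a :+ l)) refl

  entry-row-difference : ∀ a t l i → entry a t (suc l) (suc i) - entry a t l (suc i) ≡ entry a (t ∸ 1) l i
  entry-row-difference a zero    l i = binom-row-difference a (suc l) i
  entry-row-difference a (suc t) l i rewrite <?-suc (suc i) t with ⌊ suc i <? t ⌋
  ... | true  = binom-row-difference a (suc (suc l)) i
  ... | false = binom-row-difference a (suc l) i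

  -- The matrix of the corollary has determinant 1 for all a, t and sizes m:
  -- after taking row differences its first column is (1, 0, …, 0) and the
  -- remaining block is the matrix of size m - 1 with threshold t - 1.
  det-binomialMatrix : ∀ m a t → det (binomialMatrix a t {m}) ≡ + 1
  det-binomialMatrix zero    a t = refl
  det-binomialMatrix (suc n) a t = begin
      det M
        ≡⟨ det-rowDifferences M ⟨
      det (rowDifferences M)
        ≡⟨ det-first-column (rowDifferences M) first-column-below ⟩
      entry a t 0 0 * det (minor (rowDifferences M) zero)
        ≡⟨ cong₂ _*_ (entry-column0 a t 0) (det-cong block) ⟩
      + 1 * det (binomialMatrix a (t ∸ 1) {n})
        ≡⟨ *-identityˡ _ ⟩
      det (binomialMatrix a (t ∸ 1) {n})
        ≡⟨ det-binomialMatrix n a (t ∸ 1) ⟩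
      + 1 ∎
    where
    open ≡-Reasoning
    M : Matrix (suc n)
    M = binomialMatrix a t
    first-column-below : ∀ r → rowDifferences M (suc r) zero ≡ + 0
    first-column-below r = cong₂ _-_ (entry-column0 a t (suc (toℕ r))) (entry-column0 a t (toℕ (inject₁ r)))
    block : ∀ r c → minor (rowDifferences M) zero r c ≡ binomialMatrix a (t ∸ 1) r c
    block r c rewrite toℕ-inject₁ r = entry-row-difference a t (toℕ r) (toℕ c)

corollary4p16 : (a : ℤ) (m t : ℕ) → 2 ≤ t → t ≤ m →
    det {m} (λ l i → if ⌊ suc (toℕ i) <? t ⌋
                       then binom (a + + suc (suc (toℕ l))) (toℕ i)
                       else binom (a + + suc (toℕ l)) (toℕ i))
      ≡ + 1
corollary4p16 a m t _ _ = BinomialMatrix.det-binomialMatrix m a t
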